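{- Let $A$ and $B$ be part listings (words over the alphabet of parts), let $i\ge 1$, and let $G$ be a bicoloured graph. Suppose $G$ contains two edges $e_1=xy$ and $e_2=yz$ sharing a common vertex $y$ (with $x\ne z$). Let $G_1$, $G_2$, $G_{12}$ be the bicoloured graphs obtained from $G$ by deleting the edge $e_1$, the edge $e_2$, and both edges, respectively (no vertices removed). Let $P,P_1,P_2,P_{12}$ be the posets associated to the part listings $A\,b_{i,i+1}(G)\,B$, $A\,b_{i,i+1}(G_1)\,B$, $A\,b_{i,i+1}(G_2)\,B$, $A\,b_{i,i+1}(G_{12})\,B$ respectively. Then \[\mathrm{X}(P)+\mathrm{X}(P_{12})=\mathrm{X}(P_1)+\mathrm{X}(P_2).\]
   Context: A bicoloured graph is a finite graph whose vertices are coloured `down' or `up', with every edge joining a down vertex to an up vertex. A part listing is a finite ordered list of parts, each placed on positive integer levels: a part is either a single vertex on some level $i\ge 1$ (written $v_i$), or a copy of a bicoloured graph $G$ on adjacent levels $i$ and $i+1$, with its down vertices on level $i$ and up vertices on level $i+1$ (written $b_{i,i+1}(G)$); concatenation of listings is written by juxtaposition. The poset associated to a part listing $L$ has as vertex set the union of the vertices of its parts, with $x<y$ iff (i) $x$ is at least two levels below $y$; or (ii) $x$ is exactly one level below $y$ and the part containing $x$ appears strictly before the part containing $y$ in $L$; or (iii) $x$ is exactly one level below $y$ and $x,y$ are joined by an edge of a bicoloured graph part. For a finite poset $P$ with vertex set $V$, the chromatic symmetric function is $\mathrm{X}(P)=\sum_{\kappa}\prod_{v\in V}x_{\kappa(v)}$,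 summing over all maps $\kappa\colon V\to\{1,2,3,\dots\}$ such that each colour class $\kappa^{ -1}(c)$ is a chain of $P$, where $x_1,x_2,\dots$ are commuting indeterminates. -}

module Defs where

open import Data.Bool using (Bool; true; false; _∧_; _∨_; not; if_then_else_)
open import Data.Nat using (ℕ; zero; suc; _+_; _≤_)
import Data.Nat as ℕ
open import Data.Fin using (Fin; toℕ)
import Data.Fin as F
open import Data.List using (List; []; _∷_; _++_; map; concatMap; allFin; length; filterᵇ; [_])
open import Data.Bool.ListAction using (all; any)
open import Data.Vec using (Vec; lookup) renaming ([] to []ᵥ; _∷_ to _∷ᵥ_)
open import Data.Product using (_×_; Σ)
open import Data.Sum using (_⊎_)
open import Relation.Binary.PropositionalEquality using (_≡_; _≢_)
open import Relation.Nullary.Decidable using (⌊_⌋)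

-- Bicoloured graphs: `nd` down vertices, `nu` up vertices, a simple
-- edge relation between down and up vertices (given as a Bool matrix).

record BiGraph : Set where
  constructor mkBiGraph
  field
    nd   : ℕ
    nu   : ℕ
    edge : Fin nd → Fin nu → Bool
open BiGraph public

deleteEdge : (G : BiGraph) → Fin (nd G) → Fin (nu G) → BiGraph
deleteEdge G a b = mkBiGraph (nd G) (nu G)
  (λ a' b' → if ⌊ a' F.≟ a ⌋ ∧ ⌊ b' F.≟ b ⌋ then false else edge G a' b')

TwoEdgesSharingVertex : (G : BiGraph) → Fin (nd G) → Fin (nu G)
                      → Fin (nd G) → Fin (nu G) → Set
TwoEdgesSharingVertex G d1 u1 d2 u2 =
  edge G d1 u1 ≡ true × edge G d2 u2 ≡ true ×
  ((d1 ≡ d2 × u1 ≢ u2) ⊎ (u1 ≡ u2 × d1 ≢ d2))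

data Part : Set where
  v   : (i : ℕ) → Part              -- single vertex on level i
  b   : (i : ℕ) → BiGraph → Part

partLevel : Part → ℕ
partLevel (v i)   = i
partLevel (b i _) = i

Listing : Set
Listing = List Part

ValidListing : Listing → Set
ValidListing []      = Data.Unit.⊤ where import Data.Unit
ValidListing (p ∷ L) = 1 ≤ partLevel p × ValidListing L

data Tag : Set where
  single : Tag
  dn     : ℕ → Tag
  upv    : ℕ → Tag

record Vx : Set where
  constructor vx
  field
    lev  : ℕ
    pos  : ℕ      -- position of its part in the listing
    part : Part
    tag  : Tag
open Vx public

partVerts : ℕ → Part → List Vx
partVerts k p@(v i)   = [ vx i k p single ]
partVerts k p@(b i G) =
  map (λ d → vx i k p (dn (toℕ d))) (allFin (nd G)) ++
  map (λ u → vx (suc i) k p (upv (toℕ u))) (allFin (nu G))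

vertsFrom : ℕ → Listing → List Vx
vertsFrom k []      = []
vertsFrom k (p ∷ L) = partVerts k p ++ vertsFrom (suc k) L

verts : Listing → List Vx
verts = vertsFrom 0

adjℕ : BiGraph → ℕ → ℕ → Bool
adjℕ G d u = any (λ a → any (λ c → ⌊ toℕ a ℕ.≟ d ⌋ ∧ ⌊ toℕ c ℕ.≟ u ⌋ ∧ edge G a c)
                            (allFin (nu G)))
                 (allFin (nd G))

edgeTag : Part → Tag → Tag → Bool
edgeTag (b _ G) (dn d) (upv u) = adjℕ G d u
edgeTag _       _      _       = false

ltV : Vx → Vx → Bool
ltV x y =
  ⌊ suc (suc (lev x)) ℕ.≤? lev y ⌋ ∨
  (⌊ suc (lev x) ℕ.≟ lev y ⌋ ∧
     (⌊ suc (pos x) ℕ.≤? pos y ⌋ ∨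
      (⌊ pos x ℕ.≟ pos y ⌋ ∧ edgeTag (part x) (tag x) (tag y))))

-- Chromatic symmetric function, via its coefficients.
-- coeffX P k α = coefficient of x_1^{α_1} ⋯ x_k^{α_k} in X(P)
--             = #{κ : V → {1..k} | |κ⁻¹(c)| = α_c, each κ⁻¹(c) a chain}.

allVecs : (k n : ℕ) → List (Vec (Fin k) n)
allVecs k zero    = [ []ᵥ ]
allVecs k (suc n) = concatMap (λ c → map (c ∷ᵥ_) (allVecs k n)) (allFin k)

module _ (L : Listing) where
  private
    V : List Vx
    V = verts L
    n : ℕ
    n = length V
    vtx : Fin n → Vx
    vtx = Data.List.lookup V

  fibre : {k : ℕ} → Vec (Fin k) n → Fin k → ℕ
  fibre κ c = length (filterᵇ (λ j → ⌊ lookup κ j F.≟ c ⌋) (allFin n))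

  chainCol : {k : ℕ} → Vec (Fin k) n → Bool
  chainCol κ = all (λ i → all (λ j →
      not (⌊ lookup κ i F.≟ lookup κ j ⌋ ∧ not ⌊ i F.≟ j ⌋)
      ∨ ltV (vtx i) (vtx j) ∨ ltV (vtx j) (vtx i)) (allFin n)) (allFin n)

  goodCol : {k : ℕ} → Vec ℕ k → Vec (Fin k) n → Bool
  goodCol {k} α κ = chainCol κ ∧ all (λ c → ⌊ fibre κ c ℕ.≟ lookup α c ⌋) (allFin k)

  coeffX : (k : ℕ) → Vec ℕ k → ℕ
  coeffX k α = length (filterᵇ (goodCol α) (allVecs k n))

-- For S ⊆ {e₁, e₂}, the poset of the listing whose graph part keeps exactly the edges in S
-- has the comparable pairs of the poset without both edges, plus the endpoint pairs of the
-- edges in S: an edge of a graph part relates two vertices on adjacent levels and nothing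
-- else. So a colouring κ is a chain colouring for S iff S contains every edge that κ needs,
-- i.e. every edge whose endpoints get one colour but are otherwise incomparable. No κ
-- needs both edges: the two endpoints x ≠ z not shared by e₁ = xy and e₂ = yz would get
-- the colour of y, and x, z lie on one level, so κ is no chain colouring even with both
-- edges. Hence for every κ the indicator of "κ is a chain colouring with class sizes α"
-- ignores one of the two edges, so [both] + [neither] = [only e₂] + [only e₁]; summing over
-- all colourings gives the identity coefficientwise.

module Submission where

open import Defs
open import Data.Bool using (Bool; true; false; T; not; _∧_; _∨_; if_then_else_)
open import Data.Bool.ListAction using (all; any; and)
open import Data.Bool.Properties using (∧-zeroʳ; ∨-identityʳ; T-∨)
open import Data.Bool.Solver using (module ∨-∧-Solver)
open import Data.Empty using (⊥; ⊥-elim)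
open import Data.Fin using (Fin; cast; toℕ)
import Data.Fin as Fin
open import Data.Fin.Properties using (any?; cast-is-id; toℕ-injective)
open import Data.List using (List; []; _∷_; _++_; length; filterᵇ; allFin; map; lookup)
open import Data.List.Membership.Propositional.Properties using (∈-allFin; ∈-lookup)
open import Data.List.Properties using (map-cong; length-map; map-++; map-∘; map-id-local; ++-assoc)
open import Data.List.Relation.Unary.All using (All; []; _∷_)
import Data.List.Relation.Unary.All as All
open import Data.List.Relation.Unary.All.Properties using (all⁺)
import Data.List.Relation.Unary.All.Properties as AllP
open import Data.List.Relation.Unary.AllPairs using (AllPairs; []; _∷_)
import Data.List.Relation.Unary.AllPairs as AP
import Data.List.Relation.Unary.AllPairs.Properties as APP
open import Data.List.Relation.Unary.Any using (satisfied)
open import Data.List.Relation.Unary.Any.Properties using (any⁻)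
open import Data.List.Relation.Unary.Unique.Propositional.Properties using (allFin⁺)
open import Data.Nat using (ℕ; suc; _+_; _≤_; _<_; z<s)
import Data.Nat as ℕ
open import Data.Nat.Properties
  using (+-comm; +-suc; +-identityʳ; +-commutativeSemigroup; suc-injective;
         ≤-reflexive; <⇒≤; <⇒≢; <-irrefl; 1+n≢n; m<m+n)
open import Algebra.Properties.CommutativeSemigroup +-commutativeSemigroup using (interchange)
open import Data.Product using (∃₂; _×_; _,_; proj₁; proj₂)
open import Data.Sum using (_⊎_; inj₁; inj₂)
open import Data.Vec using (Vec) renaming (lookup to _!_)
open import Function using (_∘_; Equivalence)
open import Relation.Binary.PropositionalEquality
open import Relation.Nullary using (¬_; Dec; yes; no)
open import Relation.Nullary.Decidable using (⌊_⌋; T?)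

module _ {A : Set} where

  filterᵇ-cong : {p q : A → Bool} → (∀ x → p x ≡ q x) → ∀ xs → filterᵇ p xs ≡ filterᵇ q xs
  filterᵇ-cong p≗q []       = refl
  filterᵇ-cong {p} {q} p≗q (x ∷ xs) rewrite p≗q x with q x
  ... | true  = cong (x ∷_) (filterᵇ-cong p≗q xs)
  ... | false = filterᵇ-cong p≗q xs

  lookup-map : {B : Set} (f : A → B) (xs : List A) (i : Fin (length (map f xs))) →
               lookup (map f xs) i ≡ f (lookup xs (cast (length-map f xs) i))
  lookup-map f (x ∷ xs) Fin.zero    = refl
  lookup-map f (x ∷ xs) (Fin.suc i) = lookup-map f xs i

  all-cong : {p q : A → Bool} → (∀ x → p x ≡ q x) → ∀ xs → all p xs ≡ all q xs
  all-cong p≗q xs = cong and (map-cong p≗q xs)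

all-allFin : ∀ {n} (p : Fin n → Bool) → T (all p (allFin n)) → ∀ i → T (p i)
all-allFin p all-p i = All.lookup (all⁺ p _ all-p) (∈-allFin i)

all-allFin-false : ∀ {n} (p : Fin n → Bool) i → p i ≡ false → all p (allFin n) ≡ false
all-allFin-false p i pi≡false with all p (allFin _) in eq
... | false = refl
... | true  = ⊥-elim (subst T pi≡false (all-allFin p (subst T (sym eq) _) i))

indicator : Bool → ℕ
indicator c = if c then 1 else 0

length-filterᵇ-∷ : ∀ {A : Set} (p : A → Bool) x xs →
                   length (filterᵇ p (x ∷ xs)) ≡ indicator (p x) + length (filterᵇ p xs)
length-filterᵇ-∷ p x xs with p x
... | true  = refl
... | false = refl

-- Functions of two flags e₁ e₂ recording which of the two edges are present

Decomposes : (Bool → Bool → Bool) → Bool → Bool → Set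
Decomposes f d₁ d₂ = ∀ e₁ e₂ → f e₁ e₂ ≡ f false false ∨ e₁ ∧ d₁ ∨ e₂ ∧ d₂

decomposes-const : ∀ c → Decomposes (λ _ _ → c) false false
decomposes-const c e₁ e₂ rewrite ∧-zeroʳ e₁ | ∧-zeroʳ e₂ = sym (∨-identityʳ c)

decomposes-∧ : ∀ c {f d₁ d₂} → Decomposes f d₁ d₂ →
               Decomposes (λ e₁ e₂ → c ∧ f e₁ e₂) (c ∧ d₁) (c ∧ d₂)
decomposes-∧ true  hf = hf
decomposes-∧ false hf = decomposes-const false

decomposes-∨ : ∀ {f d₁ d₂ g d₁′ d₂′} → Decomposes f d₁ d₂ → Decomposes g d₁′ d₂′ →
               Decomposes (λ e₁ e₂ → f e₁ e₂ ∨ g e₁ e₂) (d₁ ∨ d₁′) (d₂ ∨ d₂′)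
decomposes-∨ {f} {d₁} {d₂} {g} {d₁′} {d₂′} hf hg e₁ e₂ =
  trans (cong₂ _∨_ (hf e₁ e₂) (hg e₁ e₂))
        (solve 8 (λ x y e₁ e₂ d₁ d₂ d₁′ d₂′ →
                    (x :+ (e₁ :* d₁ :+ e₂ :* d₂)) :+ (y :+ (e₁ :* d₁′ :+ e₂ :* d₂′))
                 := (x :+ y) :+ (e₁ :* (d₁ :+ d₁′) :+ e₂ :* (d₂ :+ d₂′)))
               refl (f false false) (g false false) e₁ e₂ d₁ d₂ d₁′ d₂′)
  where open ∨-∧-Solver

decomposes-∨ˡ : ∀ c {f d₁ d₂} → Decomposes f d₁ d₂ → Decomposes (λ e₁ e₂ → c ∨ f e₁ e₂) d₁ d₂
decomposes-∨ˡ c = decomposes-∨ (decomposes-const c)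

decomposes-any : ∀ {A : Set} {f : A → Bool → Bool → Bool} {g h : A → Bool} →
                 (∀ x → Decomposes (f x) (g x) (h x)) →
                 ∀ xs → Decomposes (λ e₁ e₂ → any (λ x → f x e₁ e₂) xs) (any g xs) (any h xs)
decomposes-any hf []       = decomposes-const false
decomposes-any hf (x ∷ xs) = decomposes-∨ (hf x) (decomposes-any hf xs)

decomposes-false : ∀ {f d₁ d₂} → Decomposes f d₁ d₂ → f true true ≡ false → ∀ e₁ e₂ → f e₁ e₂ ≡ false
decomposes-false {f} {d₁} {d₂} hf f≡false e₁ e₂ =
  trans (hf e₁ e₂) (vanishes (f false false) d₁ d₂ (trans (sym (hf true true)) f≡false))
  where
  vanishes : ∀ c d₁ d₂ → c ∨ d₁ ∨ d₂ ≡ false → c ∨ e₁ ∧ d₁ ∨ e₂ ∧ d₂ ≡ false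
  vanishes false false false _ rewrite ∧-zeroʳ e₁ | ∧-zeroʳ e₂ = refl

decomposes-ignore₁ : ∀ {f d₁ d₂} → Decomposes f d₁ d₂ → ¬ T (not (f false false) ∧ d₁) →
                     ∀ e₁ e₂ → f e₁ e₂ ≡ f false e₂
decomposes-ignore₁ {f} {d₁} {d₂} hf unneeded e₁ e₂ =
  trans (hf e₁ e₂) (trans (drop (f false false) d₁ unneeded) (sym (hf false e₂)))
  where
  drop : ∀ c d₁ → ¬ T (not c ∧ d₁) → c ∨ e₁ ∧ d₁ ∨ e₂ ∧ d₂ ≡ c ∨ false ∧ d₁ ∨ e₂ ∧ d₂
  drop true  _     _ = refl
  drop false false _ rewrite ∧-zeroʳ e₁ = refl
  drop false true  unneeded = ⊥-elim (unneeded _)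

decomposes-ignore₂ : ∀ {f d₁ d₂} → Decomposes f d₁ d₂ → ¬ T (not (f false false) ∧ d₂) →
                     ∀ e₁ e₂ → f e₁ e₂ ≡ f e₁ false
decomposes-ignore₂ {f} {d₁} {d₂} hf unneeded e₁ e₂ =
  trans (hf e₁ e₂) (trans (drop (f false false) d₂ unneeded) (sym (hf e₁ false)))
  where
  drop : ∀ c d₂ → ¬ T (not c ∧ d₂) → c ∨ e₁ ∧ d₁ ∨ e₂ ∧ d₂ ≡ c ∨ e₁ ∧ d₁ ∨ false ∧ d₂
  drop true  _     _ = refl
  drop false false _ rewrite ∧-zeroʳ e₂ = refl
  drop false true  unneeded = ⊥-elim (unneeded _)

IgnoresOne : (Bool → Bool → Bool) → Set
IgnoresOne g = (∀ e₁ e₂ → g e₁ e₂ ≡ g false e₂) ⊎ (∀ e₁ e₂ → g e₁ e₂ ≡ g e₁ false)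

ignoresOne-∧ : ∀ {g} → IgnoresOne g → ∀ c → IgnoresOne (λ e₁ e₂ → g e₁ e₂ ∧ c)
ignoresOne-∧ (inj₁ ign) c = inj₁ (λ e₁ e₂ → cong (_∧ c) (ign e₁ e₂))
ignoresOne-∧ (inj₂ ign) c = inj₂ (λ e₁ e₂ → cong (_∧ c) (ign e₁ e₂))

Square : (Bool → Bool → ℕ) → Set
Square f = f true true + f false false ≡ f false true + f true false

ignoresOne-square : ∀ {g} → IgnoresOne g → Square (λ e₁ e₂ → indicator (g e₁ e₂))
ignoresOne-square {g} (inj₁ ign) rewrite ign true true | ign true false = refl
ignoresOne-square {g} (inj₂ ign) rewrite ign true true | ign false true =
  +-comm (indicator (g true false)) _

square-cong : ∀ {f g} → (∀ e₁ e₂ → f e₁ e₂ ≡ g e₁ e₂) → Square g → Square f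
square-cong f≡g sg = trans (cong₂ _+_ (f≡g true true) (f≡g false false))
                           (trans sg (sym (cong₂ _+_ (f≡g false true) (f≡g true false))))

square-+ : ∀ {f g} → Square f → Square g → Square (λ e₁ e₂ → f e₁ e₂ + g e₁ e₂)
square-+ {f} {g} sf sg = begin
  (f true true + g true true) + (f false false + g false false)
    ≡⟨ interchange (f true true) _ _ _ ⟩
  (f true true + f false false) + (g true true + g false false)
    ≡⟨ cong₂ _+_ sf sg ⟩
  (f false true + f true false) + (g false true + g true false)
    ≡⟨ interchange (f false true) _ _ _ ⟩
  (f false true + g false true) + (f true false + g true false) ∎
  where open ≡-Reasoning

square-count : ∀ {A : Set} (p : Bool → Bool → A → Bool) → (∀ x → IgnoresOne (λ e₁ e₂ → p e₁ e₂ x)) →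
               ∀ xs → Square (λ e₁ e₂ → length (filterᵇ (p e₁ e₂) xs))
square-count p ign []       = refl
square-count p ign (x ∷ xs)
  rewrite length-filterᵇ-∷ (p true true) x xs | length-filterᵇ-∷ (p false false) x xs
        | length-filterᵇ-∷ (p false true) x xs | length-filterᵇ-∷ (p true false) x xs
  = square-+ {λ e₁ e₂ → indicator (p e₁ e₂ x)} {λ e₁ e₂ → length (filterᵇ (p e₁ e₂) xs)}
              (ignoresOne-square (ign x)) (square-count p ign xs)

-- Chromatic coefficients of an arbitrary comparability relation

hasClassSizes : ∀ {n k} → Vec ℕ k → Vec (Fin k) n → Bool
hasClassSizes {n} {k} α κ =
  all (λ c → ⌊ length (filterᵇ (λ j → ⌊ κ ! j Fin.≟ c ⌋) (allFin n)) ℕ.≟ α ! c ⌋) (allFin k)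

monochromaticPair : ∀ {n k} → Vec (Fin k) n → Fin n → Fin n → Bool
monochromaticPair κ i j = ⌊ κ ! i Fin.≟ κ ! j ⌋ ∧ not ⌊ i Fin.≟ j ⌋

module _ {n : ℕ} (comparable : Fin n → Fin n → Bool) where

  isChainColouring : ∀ {k} → Vec (Fin k) n → Bool
  isChainColouring κ =
    all (λ i → all (λ j → not (monochromaticPair κ i j) ∨ comparable i j) (allFin n)) (allFin n)

  chromaticCoeff : (k : ℕ) → Vec ℕ k → ℕ
  chromaticCoeff k α = length (filterᵇ (λ κ → isChainColouring κ ∧ hasClassSizes α κ) (allVecs k n))

comparableVx : Vx → Vx → Bool
comparableVx x y = ltV x y ∨ ltV y x

comparableIn : (V : List Vx) → Fin (length V) → Fin (length V) → Bool
comparableIn V i j = comparableVx (lookup V i) (lookup V j)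

coeffX-chromaticCoeff : ∀ L k α → coeffX L k α ≡ chromaticCoeff (comparableIn (verts L)) k α
coeffX-chromaticCoeff L k α = refl

chromaticCoeff-cong : ∀ {n} {R R′ : Fin n → Fin n → Bool} → (∀ i j → R i j ≡ R′ i j) →
                      ∀ k α → chromaticCoeff R k α ≡ chromaticCoeff R′ k α
chromaticCoeff-cong {n} R≗R′ k α = cong length (filterᵇ-cong (λ κ →
  cong (_∧ hasClassSizes α κ) (all-cong (λ i → all-cong (λ j →
    cong (not (monochromaticPair κ i j) ∨_) (R≗R′ i j)) (allFin n)) (allFin n)))
  (allVecs k n))

chromaticCoeff-cast : ∀ {m n} (eq : m ≡ n) (R : Fin n → Fin n → Bool) →
                      ∀ k α → chromaticCoeff (λ i j → R (cast eq i) (cast eq j)) k α ≡ chromaticCoeff R k α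
chromaticCoeff-cast refl R = chromaticCoeff-cong (λ i j → cong₂ R (cast-is-id refl i) (cast-is-id refl j))

chromaticCoeff-map : ∀ (f : Vx → Vx) W k α →
                     chromaticCoeff (comparableIn (map f W)) k α
                     ≡ chromaticCoeff (λ i j → comparableVx (f (lookup W i)) (f (lookup W j))) k α
chromaticCoeff-map f W k α =
  trans (chromaticCoeff-cong (λ i j → cong₂ comparableVx (lookup-map f W i) (lookup-map f W j)) k α)
        (chromaticCoeff-cast (length-map f W) (λ i j → comparableVx (f (lookup W i)) (f (lookup W j))) k α)

-- Deleting edges of a comparability relation

module _ {n : ℕ} (comparable : Bool → Bool → Fin n → Fin n → Bool) {d₁ d₂ : Fin n → Fin n → Bool}
  (comparable-decomposes : ∀ i j → Decomposes (λ e₁ e₂ → comparable e₁ e₂ i j) (d₁ i j) (d₂ i j))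
  where

  NotChainColouring : ∀ {k} → Vec (Fin k) n → Set
  NotChainColouring κ = ∃₂ λ x y → κ ! x ≡ κ ! y × x ≢ y × comparable true true x y ≡ false

  MonochromaticEdgesClash : ∀ {k} → Vec (Fin k) n → Set
  MonochromaticEdgesClash κ =
    ∀ {i j i′ j′} → T (d₁ i j) → T (d₂ i′ j′) → κ ! i ≡ κ ! j → κ ! i′ ≡ κ ! j′ → NotChainColouring κ

  module _ {k} (κ : Vec (Fin k) n) (clash : MonochromaticEdgesClash κ) where

    private
      clause : Fin n → Fin n → Bool → Bool → Bool
      clause i j e₁ e₂ = not (monochromaticPair κ i j) ∨ comparable e₁ e₂ i j

      clause-decomposes : ∀ i j → Decomposes (clause i j) (d₁ i j) (d₂ i j)
      clause-decomposes i j = decomposes-∨ˡ (not (monochromaticPair κ i j)) (comparable-decomposes i j)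

      Needs : (Fin n → Fin n → Bool) → Set
      Needs d = ∃₂ λ i j → T (not (clause i j false false) ∧ d i j)

      needs? : ∀ d → Dec (Needs d)
      needs? d = any? λ i → any? λ j → T? (not (clause i j false false) ∧ d i j)

      needed-monochromatic : ∀ (d : Fin n → Fin n → Bool) i j →
                             T (not (clause i j false false) ∧ d i j) → T (d i j) × κ ! i ≡ κ ! j
      needed-monochromatic d i j needed with κ ! i Fin.≟ κ ! j | d i j
      ... | yes κi≡κj | true  = _ , κi≡κj
      ... | no _      | _     = ⊥-elim needed
      ... | yes _     | false = ⊥-elim (subst T (∧-zeroʳ _) needed)

      ignores₁ : ¬ Needs d₁ → ∀ e₁ e₂ →
                 isChainColouring (comparable e₁ e₂) κ ≡ isChainColouring (comparable false e₂) κ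
      ignores₁ ¬needs e₁ e₂ = all-cong (λ i → all-cong (λ j →
        decomposes-ignore₁ (clause-decomposes i j) (λ t → ¬needs (i , j , t)) e₁ e₂) (allFin n)) (allFin n)

      ignores₂ : ¬ Needs d₂ → ∀ e₁ e₂ →
                 isChainColouring (comparable e₁ e₂) κ ≡ isChainColouring (comparable e₁ false) κ
      ignores₂ ¬needs e₁ e₂ = all-cong (λ i → all-cong (λ j →
        decomposes-ignore₂ (clause-decomposes i j) (λ t → ¬needs (i , j , t)) e₁ e₂) (allFin n)) (allFin n)

      needsBoth-notChain : Needs d₁ → Needs d₂ → ∀ e₁ e₂ → isChainColouring (comparable e₁ e₂) κ ≡ false
      needsBoth-notChain (i , j , needs₁) (i′ , j′ , needs₂) e₁ e₂
        with needed-monochromatic d₁ i j needs₁ | needed-monochromatic d₂ i′ j′ needs₂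
      ... | d₁ij , κij | d₂i′j′ , κi′j′ with clash d₁ij d₂i′j′ κij κi′j′
      ... | x , y , κx≡κy , x≢y , incomparable =
        all-allFin-false (λ i → all (λ j → clause i j e₁ e₂) (allFin n)) x
          (all-allFin-false (λ j → clause x j e₁ e₂) y
            (decomposes-false (clause-decomposes x y) pair-fails e₁ e₂))
        where
        pair-fails : clause x y true true ≡ false
        pair-fails with κ ! x Fin.≟ κ ! y | x Fin.≟ y
        ... | yes _    | no _    = incomparable
        ... | yes _    | yes x≡y = ⊥-elim (x≢y x≡y)
        ... | no κx≢κy | _       = ⊥-elim (κx≢κy κx≡κy)

    isChainColouring-ignoresOne : IgnoresOne (λ e₁ e₂ → isChainColouring (comparable e₁ e₂) κ)
    isChainColouring-ignoresOne with needs? d₁ | needs? d₂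
    ... | no ¬needs₁ | _          = inj₁ (ignores₁ ¬needs₁)
    ... | yes _      | no ¬needs₂ = inj₂ (ignores₂ ¬needs₂)
    ... | yes needs₁ | yes needs₂ = inj₁ λ e₁ e₂ →
      trans (needsBoth-notChain needs₁ needs₂ e₁ e₂) (sym (needsBoth-notChain needs₁ needs₂ false e₂))

  chromaticCoeff-square : (∀ {k} (κ : Vec (Fin k) n) → MonochromaticEdgesClash κ) →
                          ∀ k α → Square (λ e₁ e₂ → chromaticCoeff (comparable e₁ e₂) k α)
  chromaticCoeff-square clash k α =
    square-count (λ e₁ e₂ κ → isChainColouring (comparable e₁ e₂) κ ∧ hasClassSizes α κ)
                 (λ κ → ignoresOne-∧ (isChainColouring-ignoresOne κ (clash κ)) (hasClassSizes α κ))
                 (allVecs k n)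

-- Vertex lists of part listings

partVerts-pos : ∀ k p → All (λ x → pos x ≡ k) (partVerts k p)
partVerts-pos k (v _)   = refl ∷ []
partVerts-pos k (b _ H) = AllP.++⁺ (AllP.map⁺ (All.universal (λ _ → refl) (allFin (nd H))))
                                  (AllP.map⁺ (All.universal (λ _ → refl) (allFin (nu H))))

vertsFrom-pos≥ : ∀ k L → All (λ x → k ≤ pos x) (vertsFrom k L)
vertsFrom-pos≥ k []      = []
vertsFrom-pos≥ k (p ∷ L) = AllP.++⁺ (All.map (λ pos≡k → ≤-reflexive (sym pos≡k)) (partVerts-pos k p))
                                   (All.map <⇒≤ (vertsFrom-pos≥ (suc k) L))

vertsFrom-pos< : ∀ k L → All (λ x → pos x < k + length L) (vertsFrom k L)
vertsFrom-pos< k []      = []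
vertsFrom-pos< k (p ∷ L) =
  AllP.++⁺ (All.map (λ pos≡k → subst (_< k + suc (length L)) (sym pos≡k) (m<m+n k z<s)) (partVerts-pos k p))
          (All.map (λ {x} → subst (pos x <_) (sym (+-suc k (length L)))) (vertsFrom-pos< (suc k) L))

vertsFrom-++ : ∀ k A C → vertsFrom k (A ++ C) ≡ vertsFrom k A ++ vertsFrom (k + length A) C
vertsFrom-++ k []      C = cong (λ m → vertsFrom m C) (sym (+-identityʳ k))
vertsFrom-++ k (p ∷ A) C = begin
  partVerts k p ++ vertsFrom (suc k) (A ++ C)
    ≡⟨ cong (partVerts k p ++_) (vertsFrom-++ (suc k) A C) ⟩
  partVerts k p ++ vertsFrom (suc k) A ++ vertsFrom (suc k + length A) C
    ≡⟨ cong (λ m → partVerts k p ++ vertsFrom (suc k) A ++ vertsFrom m C) (sym (+-suc k (length A))) ⟩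
  partVerts k p ++ vertsFrom (suc k) A ++ vertsFrom (k + suc (length A)) C
    ≡⟨ ++-assoc (partVerts k p) _ _ ⟨
  (partVerts k p ++ vertsFrom (suc k) A) ++ vertsFrom (k + suc (length A)) C ∎
  where open ≡-Reasoning

setPartAt : ℕ → Part → Vx → Vx
setPartAt m q x = vx (lev x) (pos x) (if ⌊ pos x ℕ.≟ m ⌋ then q else part x) (tag x)

setPartAt-here : ∀ m q x → pos x ≡ m → setPartAt m q x ≡ vx (lev x) (pos x) q (tag x)
setPartAt-here m q x pos≡m with pos x ℕ.≟ m
... | yes _     = refl
... | no pos≢m = ⊥-elim (pos≢m pos≡m)

setPartAt-elsewhere : ∀ m q x → pos x ≢ m → setPartAt m q x ≡ x
setPartAt-elsewhere m q x pos≢m with pos x ℕ.≟ m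
... | yes pos≡m = ⊥-elim (pos≢m pos≡m)
... | no _      = refl

module _ (i : ℕ) {nd nu : ℕ} (E E′ : Fin nd → Fin nu → Bool) where

  private
    q q′ : Part
    q  = b i (mkBiGraph nd nu E)
    q′ = b i (mkBiGraph nd nu E′)

  partVerts-setPartAt : ∀ m → map (setPartAt m q′) (partVerts m q) ≡ partVerts m q′
  partVerts-setPartAt m = begin
    map (setPartAt m q′) (map down (allFin nd) ++ map up (allFin nu))
      ≡⟨ map-++ (setPartAt m q′) (map down (allFin nd)) _ ⟩
    map (setPartAt m q′) (map down (allFin nd)) ++ map (setPartAt m q′) (map up (allFin nu))
      ≡⟨ cong₂ _++_ (sym (map-∘ (allFin nd))) (sym (map-∘ (allFin nu))) ⟩
    map (setPartAt m q′ ∘ down) (allFin nd) ++ map (setPartAt m q′ ∘ up) (allFin nu)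
      ≡⟨ cong₂ _++_ (map-cong (λ d → setPartAt-here m q′ (down d) refl) (allFin nd))
                    (map-cong (λ u → setPartAt-here m q′ (up u) refl) (allFin nu)) ⟩
    partVerts m q′ ∎
    where
    open ≡-Reasoning
    down : Fin nd → Vx
    down d = vx i m q (dn (toℕ d))
    up : Fin nu → Vx
    up u = vx (suc i) m q (upv (toℕ u))

  verts-replaceGraph : ∀ A B → verts (A ++ q′ ∷ B) ≡ map (setPartAt (length A) q′) (verts (A ++ q ∷ B))
  verts-replaceGraph A B = begin
    verts (A ++ q′ ∷ B)
      ≡⟨ vertsFrom-++ 0 A (q′ ∷ B) ⟩
    verts A ++ partVerts m q′ ++ vertsFrom (suc m) B
      ≡⟨ cong₂ (λ X Z → X ++ partVerts m q′ ++ Z) (sym (map-id-local before)) (sym (map-id-local after)) ⟩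
    map f (verts A) ++ partVerts m q′ ++ map f (vertsFrom (suc m) B)
      ≡⟨ cong (λ Y → map f (verts A) ++ Y ++ map f (vertsFrom (suc m) B)) (sym (partVerts-setPartAt m)) ⟩
    map f (verts A) ++ map f (partVerts m q) ++ map f (vertsFrom (suc m) B)
      ≡⟨ cong (map f (verts A) ++_) (map-++ f (partVerts m q) _) ⟨
    map f (verts A) ++ map f (partVerts m q ++ vertsFrom (suc m) B)
      ≡⟨ map-++ f (verts A) _ ⟨
    map f (verts A ++ partVerts m q ++ vertsFrom (suc m) B)
      ≡⟨ cong (map f) (vertsFrom-++ 0 A (q ∷ B)) ⟨
    map f (verts (A ++ q ∷ B)) ∎
    where
    open ≡-Reasoning
    m : ℕ
    m = length A
    f : Vx → Vx
    f = setPartAt m q′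
    before : All (λ x → f x ≡ x) (verts A)
    before = All.map (λ pos<m → setPartAt-elsewhere m q′ _ (<⇒≢ pos<m)) (vertsFrom-pos< 0 A)
    after : All (λ x → f x ≡ x) (vertsFrom (suc m) B)
    after = All.map (λ m<pos → setPartAt-elsewhere m q′ _ (≢-sym (<⇒≢ m<pos))) (vertsFrom-pos≥ (suc m) B)

KeysDistinct : Vx → Vx → Set
KeysDistinct x y = pos x ≡ pos y → tag x ≢ tag y

keysDistinct-sym : ∀ {x y} → KeysDistinct x y → KeysDistinct y x
keysDistinct-sym distinct pos≡ tag≡ = distinct (sym pos≡) (sym tag≡)

dn-injective : ∀ {m m′} → dn m ≡ dn m′ → m ≡ m′
dn-injective refl = refl

upv-injective : ∀ {m m′} → upv m ≡ upv m′ → m ≡ m′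
upv-injective refl = refl

partVerts-keysDistinct : ∀ k p → AllPairs KeysDistinct (partVerts k p)
partVerts-keysDistinct k (v _)   = [] ∷ []
partVerts-keysDistinct k (b _ H) = APP.++⁺
  (APP.map⁺ (AP.map (λ d≢d′ _ tag≡ → d≢d′ (toℕ-injective (dn-injective tag≡))) (allFin⁺ (nd H))))
  (APP.map⁺ (AP.map (λ u≢u′ _ tag≡ → u≢u′ (toℕ-injective (upv-injective tag≡))) (allFin⁺ (nu H))))
  (AllP.map⁺ (All.universal (λ _ → AllP.map⁺ (All.universal (λ _ _ ()) _)) _))

vertsFrom-keysDistinct : ∀ k L → AllPairs KeysDistinct (vertsFrom k L)
vertsFrom-keysDistinct k []      = []
vertsFrom-keysDistinct k (p ∷ L) = APP.++⁺ (partVerts-keysDistinct k p) (vertsFrom-keysDistinct (suc k) L)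
  (All.map (λ pos≡k → All.map (λ k<pos pos≡ _ → <-irrefl (trans (sym pos≡k) pos≡) k<pos)
                              (vertsFrom-pos≥ (suc k) L))
           (partVerts-pos k p))

allPairs-lookup : ∀ {A : Set} {R : A → A → Set} → (∀ {x y} → R x y → R y x) →
                  ∀ {xs} → AllPairs R xs → ∀ {i j} → i ≢ j → R (lookup xs i) (lookup xs j)
allPairs-lookup R-sym (Rx ∷ Rxs) {Fin.zero}  {Fin.zero}  i≢j = ⊥-elim (i≢j refl)
allPairs-lookup R-sym (Rx ∷ Rxs) {Fin.zero}  {Fin.suc j} _   = All.lookup Rx (∈-lookup j)
allPairs-lookup R-sym (Rx ∷ Rxs) {Fin.suc i} {Fin.zero}  _   = R-sym (All.lookup Rx (∈-lookup i))
allPairs-lookup R-sym (Rx ∷ Rxs) {Fin.suc i} {Fin.suc j} i≢j = allPairs-lookup R-sym Rxs (i≢j ∘ cong Fin.suc)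

verts-key-injective : ∀ L {i j : Fin (length (verts L))} →
                      pos (lookup (verts L) i) ≡ pos (lookup (verts L) j) →
                      tag (lookup (verts L) i) ≡ tag (lookup (verts L) j) → i ≡ j
verts-key-injective L {i} {j} pos≡ tag≡ with i Fin.≟ j
... | yes i≡j = i≡j
... | no i≢j  = ⊥-elim (allPairs-lookup (λ {x} {y} → keysDistinct-sym {x} {y})
                                        (vertsFrom-keysDistinct 0 L) i≢j pos≡ tag≡)

ltV-sameLevel : ∀ x y → lev x ≡ lev y → ltV x y ≡ false
ltV-sameLevel x y lev≡ with suc (suc (lev x)) ℕ.≤? lev y | suc (lev x) ℕ.≟ lev y
... | no _         | no _      = refl
... | yes 2+x≤y    | _         = ⊥-elim (<-irrefl lev≡ (<⇒≤ {suc (lev x)} 2+x≤y))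
... | no _         | yes 1+x≡y = ⊥-elim (1+n≢n (trans 1+x≡y (sym lev≡)))

-- Deleting two edges sharing a vertex

keepIf : Bool → Bool → Bool → Bool
keepIf true  isDeleted present = present
keepIf false isDeleted present = if isDeleted then false else present

keepIf-decomposes : ∀ E m₁ m₂ → (T m₁ → T E) → (T m₂ → T E) → (T m₁ → T m₂ → ⊥) →
                    Decomposes (λ e₁ e₂ → keepIf e₂ m₂ (keepIf e₁ m₁ E)) m₁ m₂
keepIf-decomposes _     true  true  _  _  excl  = ⊥-elim (excl _ _)
keepIf-decomposes false true  false E₁ _  _     = ⊥-elim (E₁ _)
keepIf-decomposes false false true  _  E₂ _     = ⊥-elim (E₂ _)
keepIf-decomposes false false false _ _ _ true  true  = refl
keepIf-decomposes false false false _ _ _ true  false = refl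
keepIf-decomposes false false false _ _ _ false true  = refl
keepIf-decomposes false false false _ _ _ false false = refl
keepIf-decomposes true  false false _ _ _ true  true  = refl
keepIf-decomposes true  false false _ _ _ true  false = refl
keepIf-decomposes true  false false _ _ _ false true  = refl
keepIf-decomposes true  false false _ _ _ false false = refl
keepIf-decomposes true  true  false _ _ _ true  true  = refl
keepIf-decomposes true  true  false _ _ _ true  false = refl
keepIf-decomposes true  true  false _ _ _ false true  = refl
keepIf-decomposes true  true  false _ _ _ false false = refl
keepIf-decomposes true  false true  _ _ _ true  true  = refl
keepIf-decomposes true  false true  _ _ _ true  false = refl
keepIf-decomposes true  false true  _ _ _ false true  = refl
keepIf-decomposes true  false true  _ _ _ false false = refl

module TwoEdgeDeletion (A B : Listing) (i : ℕ) (G : BiGraph)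
  (d₁ : Fin (nd G)) (u₁ : Fin (nu G)) (d₂ : Fin (nd G)) (u₂ : Fin (nu G))
  (twoEdges : TwoEdgesSharingVertex G d₁ u₁ d₂ u₂) where

  isEdge : Fin (nd G) → Fin (nu G) → Fin (nd G) → Fin (nu G) → Bool
  isEdge d u a c = ⌊ a Fin.≟ d ⌋ ∧ ⌊ c Fin.≟ u ⌋

  isEdge-sound : ∀ d u a c → T (isEdge d u a c) → a ≡ d × c ≡ u
  isEdge-sound d u a c t with a Fin.≟ d | c Fin.≟ u
  ... | yes a≡d | yes c≡u = a≡d , c≡u

  singleEdge : Fin (nd G) → Fin (nu G) → BiGraph
  singleEdge d u = mkBiGraph (nd G) (nu G) (isEdge d u)

  -- keepEdges true true, false true, true false and false false are definitionally G,
  -- deleteEdge G d₁ u₁, deleteEdge G d₂ u₂ and deleteEdge (deleteEdge G d₁ u₁) d₂ u₂.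
  keepEdges : Bool → Bool → BiGraph
  keepEdges e₁ e₂ = mkBiGraph (nd G) (nu G) λ a c →
    keepIf e₂ (isEdge d₂ u₂ a c) (keepIf e₁ (isEdge d₁ u₁ a c) (edge G a c))

  keptEdge-decomposes : ∀ a c → Decomposes (λ e₁ e₂ → edge (keepEdges e₁ e₂) a c)
                                           (isEdge d₁ u₁ a c) (isEdge d₂ u₂ a c)
  keptEdge-decomposes a c =
    keepIf-decomposes (edge G a c) _ _ (present (proj₁ twoEdges)) (present (proj₁ (proj₂ twoEdges))) distinct
    where
    present : ∀ {d u} → edge G d u ≡ true → T (isEdge d u a c) → T (edge G a c)
    present {d} {u} d-u t with isEdge-sound d u a c t
    ... | refl , refl = subst T (sym d-u) _
    distinct : T (isEdge d₁ u₁ a c) → T (isEdge d₂ u₂ a c) → ⊥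
    distinct t₁ t₂
      with isEdge-sound d₁ u₁ a c t₁ | isEdge-sound d₂ u₂ a c t₂ | proj₂ (proj₂ twoEdges)
    ... | refl , refl | refl , refl | inj₁ (_ , u≢u) = u≢u refl
    ... | refl , refl | refl , refl | inj₂ (_ , d≢d) = d≢d refl

  adjℕ-decomposes : ∀ d u → Decomposes (λ e₁ e₂ → adjℕ (keepEdges e₁ e₂) d u)
                                       (adjℕ (singleEdge d₁ u₁) d u) (adjℕ (singleEdge d₂ u₂) d u)
  adjℕ-decomposes d u =
    decomposes-any (λ a → decomposes-any (λ c →
      decomposes-∧ ⌊ toℕ a ℕ.≟ d ⌋ (decomposes-∧ ⌊ toℕ c ℕ.≟ u ⌋ (keptEdge-decomposes a c)))
      (allFin (nu G))) (allFin (nd G))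

  edgeTag-decomposes : ∀ t t′ → Decomposes (λ e₁ e₂ → edgeTag (b i (keepEdges e₁ e₂)) t t′)
                                            (edgeTag (b i (singleEdge d₁ u₁)) t t′)
                                            (edgeTag (b i (singleEdge d₂ u₂)) t t′)
  edgeTag-decomposes (dn d)   (upv u)  = adjℕ-decomposes d u
  edgeTag-decomposes (dn _)   single   = decomposes-const false
  edgeTag-decomposes (dn _)   (dn _)   = decomposes-const false
  edgeTag-decomposes single   _        = decomposes-const false
  edgeTag-decomposes (upv _)  _        = decomposes-const false

  M : ℕ
  M = length A

  W : List Vx
  W = verts (A ++ b i G ∷ B)

  n : ℕ
  n = length W

  relabel : Bool → Bool → Vx → Vx
  relabel e₁ e₂ = setPartAt M (b i (keepEdges e₁ e₂))

  edgeContribution : BiGraph → Vx → Vx → Bool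
  edgeContribution H x y =
    ⌊ suc (lev x) ℕ.≟ lev y ⌋ ∧ (⌊ pos x ℕ.≟ pos y ⌋ ∧ (⌊ pos x ℕ.≟ M ⌋ ∧ edgeTag (b i H) (tag x) (tag y)))

  ltV-decomposes : ∀ x y → Decomposes (λ e₁ e₂ → ltV (relabel e₁ e₂ x) (relabel e₁ e₂ y))
                                      (edgeContribution (singleEdge d₁ u₁) x y)
                                      (edgeContribution (singleEdge d₂ u₂) x y)
  ltV-decomposes x y =
    decomposes-∨ˡ ⌊ suc (suc (lev x)) ℕ.≤? lev y ⌋ (decomposes-∧ ⌊ suc (lev x) ℕ.≟ lev y ⌋
      (decomposes-∨ˡ ⌊ suc (pos x) ℕ.≤? pos y ⌋ (decomposes-∧ ⌊ pos x ℕ.≟ pos y ⌋ (atM ⌊ pos x ℕ.≟ M ⌋))))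
    where
    atM : ∀ s → Decomposes (λ e₁ e₂ → edgeTag (if s then b i (keepEdges e₁ e₂) else part x) (tag x) (tag y))
                           (s ∧ edgeTag (b i (singleEdge d₁ u₁)) (tag x) (tag y))
                           (s ∧ edgeTag (b i (singleEdge d₂ u₂)) (tag x) (tag y))
    atM true  = edgeTag-decomposes (tag x) (tag y)
    atM false = decomposes-const _

  comparable : Bool → Bool → Fin n → Fin n → Bool
  comparable e₁ e₂ j j′ = comparableVx (relabel e₁ e₂ (lookup W j)) (relabel e₁ e₂ (lookup W j′))

  edgeRelation : BiGraph → Fin n → Fin n → Bool
  edgeRelation H j j′ =
    edgeContribution H (lookup W j) (lookup W j′) ∨ edgeContribution H (lookup W j′) (lookup W j)

  comparable-decomposes : ∀ j j′ → Decomposes (λ e₁ e₂ → comparable e₁ e₂ j j′)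
                                              (edgeRelation (singleEdge d₁ u₁) j j′)
                                              (edgeRelation (singleEdge d₂ u₂) j j′)
  comparable-decomposes j j′ = decomposes-∨ (ltV-decomposes (lookup W j) (lookup W j′))
                                            (ltV-decomposes (lookup W j′) (lookup W j))

  record IsEdge (d : Fin (nd G)) (u : Fin (nu G)) (x y : Fin n) : Set where
    field
      levels   : suc (lev (lookup W x)) ≡ lev (lookup W y)
      down-pos : pos (lookup W x) ≡ M
      up-pos   : pos (lookup W y) ≡ M
      down-tag : tag (lookup W x) ≡ dn (toℕ d)
      up-tag   : tag (lookup W y) ≡ upv (toℕ u)
  open IsEdge

  edgeTag-singleEdge : ∀ {d u} t t′ → T (edgeTag (b i (singleEdge d u)) t t′) →
                       t ≡ dn (toℕ d) × t′ ≡ upv (toℕ u)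
  edgeTag-singleEdge {d} {u} (dn d′) (upv u′) t
    with satisfied (any⁻ _ (allFin (nd G)) t)
  ... | a , t₁ with satisfied (any⁻ _ (allFin (nu G)) t₁)
  ... | c , t₂ with toℕ a ℕ.≟ d′ | toℕ c ℕ.≟ u′
  ... | yes a≡d′ | yes c≡u′ with isEdge-sound d u a c t₂
  ...   | refl , refl = cong dn (sym a≡d′) , cong upv (sym c≡u′)
  edgeTag-singleEdge {d} {u} (dn d′) (upv u′) t | a , t₁ | c , t₂ | no _  | _     = ⊥-elim t₂
  edgeTag-singleEdge {d} {u} (dn d′) (upv u′) t | a , t₁ | c , t₂ | yes _ | no _  = ⊥-elim t₂

  edgeContribution-isEdge : ∀ {d u} x y → T (edgeContribution (singleEdge d u) (lookup W x) (lookup W y)) →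
                            IsEdge d u x y
  edgeContribution-isEdge {d} {u} x y t
    with suc (lev (lookup W x)) ℕ.≟ lev (lookup W y) | pos (lookup W x) ℕ.≟ pos (lookup W y)
       | pos (lookup W x) ℕ.≟ M
  ... | yes lev≡ | yes pos≡ | yes atM =
    let down , up = edgeTag-singleEdge {d} {u} (tag (lookup W x)) (tag (lookup W y)) t
    in  record { levels = lev≡ ; down-pos = atM ; up-pos = trans (sym pos≡) atM
               ; down-tag = down ; up-tag = up }
  ... | no _  | _     | _     = ⊥-elim t
  ... | yes _ | no _  | _     = ⊥-elim t
  ... | yes _ | yes _ | no _  = ⊥-elim t

  monochromaticEdge : ∀ {k} (κ : Vec (Fin k) n) {d u j j′} → T (edgeRelation (singleEdge d u) j j′) →
                      κ ! j ≡ κ ! j′ → ∃₂ λ x y → IsEdge d u x y × κ ! x ≡ κ ! y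
  monochromaticEdge κ {d} {u} {j} {j′} t κj≡κj′ with Equivalence.to T-∨ t
  ... | inj₁ t₁ = j  , j′ , edgeContribution-isEdge j j′ t₁ , κj≡κj′
  ... | inj₂ t₂ = j′ , j  , edgeContribution-isEdge j′ j t₂ , sym κj≡κj′

  sameLevel-incomparable : ∀ x y → lev (lookup W x) ≡ lev (lookup W y) → comparable true true x y ≡ false
  sameLevel-incomparable x y lev≡ =
    cong₂ _∨_ (ltV-sameLevel (relabel true true (lookup W x)) (relabel true true (lookup W y)) lev≡)
              (ltV-sameLevel (relabel true true (lookup W y)) (relabel true true (lookup W x)) (sym lev≡))

  monochromaticEdges-clash : ∀ {k} (κ : Vec (Fin k) n) →
                             MonochromaticEdgesClash comparable comparable-decomposes κ
  monochromaticEdges-clash κ t₁ t₂ κ₁ κ₂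
    with monochromaticEdge κ t₁ κ₁ | monochromaticEdge κ t₂ κ₂ | proj₂ (proj₂ twoEdges)
  ... | x₁ , y₁ , E₁ , κx₁≡κy₁ | x₂ , y₂ , E₂ , κx₂≡κy₂ | inj₁ (d₁≡d₂ , u₁≢u₂) =
    y₁ , y₂ , κy₁≡κy₂ , y₁≢y₂ , sameLevel-incomparable y₁ y₂ (begin
      lev (lookup W y₁)       ≡⟨ levels E₁ ⟨
      suc (lev (lookup W x₁)) ≡⟨ cong (suc ∘ lev ∘ lookup W) x₁≡x₂ ⟩
      suc (lev (lookup W x₂)) ≡⟨ levels E₂ ⟩
      lev (lookup W y₂)       ∎)
    where
    open ≡-Reasoning
    x₁≡x₂ : x₁ ≡ x₂
    x₁≡x₂ = verts-key-injective (A ++ b i G ∷ B) (trans (down-pos E₁) (sym (down-pos E₂)))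
              (trans (down-tag E₁) (trans (cong (dn ∘ toℕ) d₁≡d₂) (sym (down-tag E₂))))
    κy₁≡κy₂ : κ ! y₁ ≡ κ ! y₂
    κy₁≡κy₂ = trans (sym κx₁≡κy₁) (trans (cong (κ !_) x₁≡x₂) κx₂≡κy₂)
    y₁≢y₂ : y₁ ≢ y₂
    y₁≢y₂ y₁≡y₂ = u₁≢u₂ (toℕ-injective (upv-injective
      (trans (sym (up-tag E₁)) (trans (cong (tag ∘ lookup W) y₁≡y₂) (up-tag E₂)))))
  ... | x₁ , y₁ , E₁ , κx₁≡κy₁ | x₂ , y₂ , E₂ , κx₂≡κy₂ | inj₂ (u₁≡u₂ , d₁≢d₂) =
    x₁ , x₂ , κx₁≡κx₂ , x₁≢x₂ , sameLevel-incomparable x₁ x₂ (suc-injective (begin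
      suc (lev (lookup W x₁)) ≡⟨ levels E₁ ⟩
      lev (lookup W y₁)       ≡⟨ cong (lev ∘ lookup W) y₁≡y₂ ⟩
      lev (lookup W y₂)       ≡⟨ levels E₂ ⟨
      suc (lev (lookup W x₂)) ∎))
    where
    open ≡-Reasoning
    y₁≡y₂ : y₁ ≡ y₂
    y₁≡y₂ = verts-key-injective (A ++ b i G ∷ B) (trans (up-pos E₁) (sym (up-pos E₂)))
              (trans (up-tag E₁) (trans (cong (upv ∘ toℕ) u₁≡u₂) (sym (up-tag E₂))))
    κx₁≡κx₂ : κ ! x₁ ≡ κ ! x₂
    κx₁≡κx₂ = trans κx₁≡κy₁ (trans (cong (κ !_) y₁≡y₂) (sym κx₂≡κy₂))
    x₁≢x₂ : x₁ ≢ x₂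
    x₁≢x₂ x₁≡x₂ = d₁≢d₂ (toℕ-injective (dn-injective
      (trans (sym (down-tag E₁)) (trans (cong (tag ∘ lookup W) x₁≡x₂) (down-tag E₂)))))

  coeffX-keepEdges : ∀ e₁ e₂ k α →
                     coeffX (A ++ b i (keepEdges e₁ e₂) ∷ B) k α ≡ chromaticCoeff (comparable e₁ e₂) k α
  coeffX-keepEdges e₁ e₂ k α = begin
    coeffX (A ++ b i (keepEdges e₁ e₂) ∷ B) k α
      ≡⟨ coeffX-chromaticCoeff (A ++ b i (keepEdges e₁ e₂) ∷ B) k α ⟩
    chromaticCoeff (comparableIn (verts (A ++ b i (keepEdges e₁ e₂) ∷ B))) k α
      ≡⟨ cong (λ V → chromaticCoeff (comparableIn V) k α) (verts-replaceGraph i (edge G) _ A B) ⟩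
    chromaticCoeff (comparableIn (map (relabel e₁ e₂) W)) k α
      ≡⟨ chromaticCoeff-map (relabel e₁ e₂) W k α ⟩
    chromaticCoeff (comparable e₁ e₂) k α ∎
    where open ≡-Reasoning

  coeffX-square : ∀ k α → Square (λ e₁ e₂ → coeffX (A ++ b i (keepEdges e₁ e₂) ∷ B) k α)
  coeffX-square k α = square-cong (λ e₁ e₂ → coeffX-keepEdges e₁ e₂ k α)
    (chromaticCoeff-square comparable comparable-decomposes monochromaticEdges-clash k α)

mainTheorem3 : (A B : Listing) → ValidListing A → ValidListing B
    → (i : ℕ) → 1 ≤ i → (G : BiGraph)
    → (d1 : Fin (nd G)) (u1 : Fin (nu G)) (d2 : Fin (nd G)) (u2 : Fin (nu G))
    → TwoEdgesSharingVertex G d1 u1 d2 u2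
    → (k : ℕ) (α : Vec ℕ k)
    → coeffX (A ++ b i G ∷ B) k α
        + coeffX (A ++ b i (deleteEdge (deleteEdge G d1 u1) d2 u2) ∷ B) k α
      ≡ coeffX (A ++ b i (deleteEdge G d1 u1) ∷ B) k α
        + coeffX (A ++ b i (deleteEdge G d2 u2) ∷ B) k α
-- The identity holds on arbitrary levels.
mainTheorem3 A B _ _ i _ G d1 u1 d2 u2 twoEdges =
  TwoEdgeDeletion.coeffX-square A B i G d1 u1 d2 u2 twoEdges
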